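{- Let $G$ be a finite group and let $Max_G=\{x_1,\dots,x_m\}$ be an essential cyclic set of $G$. If $icn(G)\geq 3$, then $rc(\Gamma_G^e)\geq 3$.
   Context: Let $G$ be a finite group with identity $e$. The enhanced power graph $\Gamma_G^e$ has vertex set $G$, two distinct vertices $x,y$ being adjacent iff $x,y\in\langle z\rangle$ for some $z\in G$. For a connected graph $\Gamma$, an edge-colouring $\zeta:E(\Gamma)\to\{1,\dots,k\}$ (not necessarily proper) is a rainbow $k$-colouring if every pair of distinct vertices is joined by a path whose edges have pairwise distinct colours; $rc(\Gamma)$ is the minimum such $k$. An essential cyclic set $Max_G=\{x_1,\dots,x_m\}$ is a set of elements of $G$ such that $\langle x_1\rangle,\dots,\langle x_m\rangle$ are pairwise distinct and are exactly the maximal cyclic subgroups of $G$. The independence cyclic set is $ics(G)=\{x_i\in Max_G:\langle x_i\rangle\cap\langle x_j\rangle=\{e\}\text{ for all }j\neq i\}$ and $icn(G)=|ics(G)|$. -}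

module Defs where

open import Data.Nat using (ℕ; zero; suc; _≤_)
open import Data.Fin using (Fin)
open import Data.List using (List; []; _∷_)
open import Data.List.Relation.Unary.Unique.Propositional using (Unique)
open import Data.Product using (Σ; ∃; _×_; _,_)
open import Relation.Binary.PropositionalEquality using (_≡_; _≢_)
open import Relation.Nullary using (¬_)

-- A finite group, presented (up to isomorphism) on the carrier Fin order,
-- with propositional equality.
record FiniteGroup : Set where
  field
    order : ℕ
  Carrier : Set
  Carrier = Fin order
  field
    _∙_     : Carrier → Carrier → Carrier
    e       : Carrier
    _⁻¹     : Carrier → Carrier
    assoc   : ∀ x y z → (x ∙ y) ∙ z ≡ x ∙ (y ∙ z)
    identityˡ : ∀ x → e ∙ x ≡ x
    identityʳ : ∀ x → x ∙ e ≡ x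
    inverseˡ  : ∀ x → (x ⁻¹) ∙ x ≡ e
    inverseʳ  : ∀ x → x ∙ (x ⁻¹) ≡ e

module _ (G : FiniteGroup) where
  open FiniteGroup G

  pow : Carrier → ℕ → Carrier
  pow x zero    = e
  pow x (suc k) = x ∙ pow x k

  -- y ∈ ⟨z⟩  (in a finite group the cyclic subgroup ⟨z⟩ is {z^k | k ∈ ℕ})
  _∈⟨_⟩ : Carrier → Carrier → Set
  y ∈⟨ z ⟩ = ∃ λ (k : ℕ) → y ≡ pow z k

  _⊆⟨⟩_ : Carrier → Carrier → Set
  x ⊆⟨⟩ y = ∀ g → g ∈⟨ x ⟩ → g ∈⟨ y ⟩

  _≈⟨⟩_ : Carrier → Carrier → Set
  x ≈⟨⟩ y = (x ⊆⟨⟩ y) × (y ⊆⟨⟩ x)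

  MaximalCyclic : Carrier → Set
  MaximalCyclic x = ∀ z → x ⊆⟨⟩ z → z ⊆⟨⟩ x

  record IsEssentialCyclicSet (m : ℕ) (xs : Fin m → Carrier) : Set where
    field
      distinct   : ∀ i j → i ≢ j → ¬ (xs i ≈⟨⟩ xs j)
      maximal    : ∀ i → MaximalCyclic (xs i)
      exhaustive : ∀ z → MaximalCyclic z → ∃ λ i → z ≈⟨⟩ xs i

  InIcs : ∀ {m} → (Fin m → Carrier) → Fin m → Set
  InIcs xs i = ∀ j → j ≢ i → ∀ g → g ∈⟨ xs i ⟩ → g ∈⟨ xs j ⟩ → g ≡ e

  IcnAtLeast3 : ∀ {m} → (Fin m → Carrier) → Set
  IcnAtLeast3 {m} xs = Σ (Fin m) λ i → Σ (Fin m) λ j → Σ (Fin m) λ k →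
    (i ≢ j) × (i ≢ k) × (j ≢ k) × InIcs xs i × InIcs xs j × InIcs xs k

  Adj : Carrier → Carrier → Set
  Adj x y = (x ≢ y) × ∃ λ z → (x ∈⟨ z ⟩) × (y ∈⟨ z ⟩)

  data Walk (x : Carrier) : Carrier → Set where
    here : Walk x x
    step : ∀ {y z} → Walk x y → Adj y z → Walk x z

  vertices : ∀ {x y} → Walk x y → List Carrier
  vertices {x} here = x ∷ []
  vertices (step {z = z} w _) = z ∷ vertices w

  -- an edge-colouring with colours in Fin k (a symmetric colour function;
  -- only its values on edges are relevant)
  record EdgeColouring (k : ℕ) : Set where
    field
      colour : Carrier → Carrier → Fin k
      sym    : ∀ x y → Adj x y → colour x y ≡ colour y x

  module _ {k : ℕ} (ζ : EdgeColouring k) where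
    open EdgeColouring ζ

    colours : ∀ {x y} → Walk x y → List (Fin k)
    colours here = []
    colours (step {y} {z} w _) = colour y z ∷ colours w

    RainbowPath : ∀ {x y} → Walk x y → Set
    RainbowPath w = Unique (vertices w) × Unique (colours w)

    IsRainbowColouring : Set
    IsRainbowColouring = ∀ x y → x ≢ y → Σ (Walk x y) RainbowPath

  -- rc(Γ_G^e) ≥ r : no rainbow k-colouring exists for k < r,
  -- i.e. every k admitting a rainbow k-colouring satisfies r ≤ k
  RcAtLeast : ℕ → Set
  RcAtLeast r = ∀ k → (ζ : EdgeColouring k) → IsRainbowColouring ζ → r ≤ k

module Submission where

-- Let x_i, x_j, x_l be three distinct members of ics(G).  For two
-- of them, x_a and x_b with x_a ∈ ics(G), every neighbour of x_a in Γ_G^e lies in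
-- ⟨x_a⟩ (by maximality of ⟨x_a⟩), so a common neighbour of x_a and x_b lies in
-- ⟨x_a⟩ ∩ ⟨x_b⟩ = {e}; in particular x_a, x_b are not adjacent and e is their only
-- common neighbour.  Hence a rainbow path from x_a to x_b either has at least three
-- edges (so at least three colours are used) or it is x_a — e — x_b, which forces
-- colour(x_a,e) ≠ colour(e,x_b).  So if fewer than three colours were available,
-- the three edges x_i e, x_j e, x_l e would carry pairwise distinct colours, which
-- is again impossible.

open import Defs
open import Data.Nat using (ℕ; zero; suc; _≤_; _+_; _*_)
open import Data.Nat.Properties using (_≤?_)
open import Data.Fin using (Fin; zero; suc)
open import Data.Fin.Properties using (injective⇒≤)
open import Data.List.Relation.Unary.All using (_∷_)
open import Data.List.Relation.Unary.AllPairs using (_∷_)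
open import Data.List.Relation.Unary.Unique.Propositional using (Unique)
open import Data.Product using (_,_; proj₁; proj₂)
open import Function.Definitions using (Injective)
open import Relation.Binary.PropositionalEquality
open import Relation.Nullary using (¬_; yes; no; contradiction)

three-distinct⇒3≤ : ∀ {k} {a b c : Fin k} → a ≢ b → a ≢ c → b ≢ c → 3 ≤ k
three-distinct⇒3≤ {k} {a} {b} {c} a≢b a≢c b≢c = injective⇒≤ triple-injective
  where
  triple : Fin 3 → Fin k
  triple zero             = a
  triple (suc zero)       = b
  triple (suc (suc zero)) = c

  triple-injective : Injective _≡_ _≡_ triple
  triple-injective {zero}             {zero}             _  = refl
  triple-injective {zero}             {suc zero}         eq = contradiction eq a≢b
  triple-injective {zero}             {suc (suc zero)}   eq = contradiction eq a≢c
  triple-injective {suc zero}         {zero}             eq = contradiction (sym eq) a≢b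
  triple-injective {suc zero}         {suc zero}         _  = refl
  triple-injective {suc zero}         {suc (suc zero)}   eq = contradiction eq b≢c
  triple-injective {suc (suc zero)}   {zero}             eq = contradiction (sym eq) a≢c
  triple-injective {suc (suc zero)}   {suc zero}         eq = contradiction (sym eq) b≢c
  triple-injective {suc (suc zero)}   {suc (suc zero)}   _  = refl

module CyclicSubgroups (G : FiniteGroup) where
  open FiniteGroup G

  pow-+ : ∀ z a b → pow G z (a + b) ≡ pow G z a ∙ pow G z b
  pow-+ z zero    b = sym (identityˡ _)
  pow-+ z (suc a) b = begin
    z ∙ pow G z (a + b)           ≡⟨ cong (z ∙_) (pow-+ z a b) ⟩
    z ∙ (pow G z a ∙ pow G z b)   ≡⟨ sym (assoc _ _ _) ⟩
    (z ∙ pow G z a) ∙ pow G z b   ∎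
    where open ≡-Reasoning

  pow-pow : ∀ z a n → pow G (pow G z a) n ≡ pow G z (n * a)
  pow-pow z a zero    = refl
  pow-pow z a (suc n) = begin
    pow G z a ∙ pow G (pow G z a) n   ≡⟨ cong (pow G z a ∙_) (pow-pow z a n) ⟩
    pow G z a ∙ pow G z (n * a)       ≡⟨ sym (pow-+ z a (n * a)) ⟩
    pow G z (a + n * a)               ∎
    where open ≡-Reasoning

  ∈⟨self⟩ : ∀ x → _∈⟨_⟩ G x x
  ∈⟨self⟩ x = 1 , sym (identityʳ x)

  ∈⇒⊆ : ∀ {x z} → _∈⟨_⟩ G x z → _⊆⟨⟩_ G x z
  ∈⇒⊆ {x} {z} (a , x≡zᵃ) g (n , g≡xⁿ) = n * a , (begin
    g                   ≡⟨ g≡xⁿ ⟩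
    pow G x n           ≡⟨ cong (λ t → pow G t n) x≡zᵃ ⟩
    pow G (pow G z a) n ≡⟨ pow-pow z a n ⟩
    pow G z (n * a)     ∎)
    where open ≡-Reasoning

  ⟨e⟩⊆ : ∀ z → _⊆⟨⟩_ G e z
  ⟨e⟩⊆ z = ∈⇒⊆ (0 , refl)

  ≡⇒≈⟨⟩ : ∀ {x y} → x ≡ y → _≈⟨⟩_ G x y
  ≡⇒≈⟨⟩ refl = (λ _ g∈ → g∈) , (λ _ g∈ → g∈)

  Adj-sym : ∀ {x y} → Adj G x y → Adj G y x
  Adj-sym (x≢y , z , x∈⟨z⟩ , y∈⟨z⟩) = (λ y≡x → x≢y (sym y≡x)) , z , y∈⟨z⟩ , x∈⟨z⟩

  adjacent-to-e : ∀ {x} → x ≢ e → Adj G x e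
  adjacent-to-e {x} x≢e = x≢e , x , ∈⟨self⟩ x , (0 , refl)

  -- If ⟨x⟩ is a maximal cyclic subgroup, the neighbours of x all lie in ⟨x⟩:
  -- x, y ∈ ⟨z⟩ gives ⟨x⟩ ⊆ ⟨z⟩, hence ⟨z⟩ = ⟨x⟩ by maximality.
  maximal-neighbour : ∀ {x y} → MaximalCyclic G x → Adj G x y → _∈⟨_⟩ G y x
  maximal-neighbour {y = y} max-x (_ , z , x∈⟨z⟩ , y∈⟨z⟩) =
    max-x z (∈⇒⊆ x∈⟨z⟩) y y∈⟨z⟩

  module Independence {m} {xs : Fin m → Carrier}
                      (ess : IsEssentialCyclicSet G m xs) where
    open IsEssentialCyclicSet ess

    -- As soon as there are two generators, none of them is e: ⟨e⟩ ⊆ ⟨x_b⟩ and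
    -- maximality of ⟨x_a⟩ = ⟨e⟩ would give ⟨x_a⟩ = ⟨x_b⟩.
    generator-≢-e : ∀ {a b} → a ≢ b → xs a ≢ e
    generator-≢-e {a} {b} a≢b xₐ≡e = distinct a b a≢b (xₐ⊆x_b , maximal a (xs b) xₐ⊆x_b)
      where
      xₐ⊆x_b : _⊆⟨⟩_ G (xs a) (xs b)
      xₐ⊆x_b = subst (λ t → _⊆⟨⟩_ G t (xs b)) (sym xₐ≡e) (⟨e⟩⊆ (xs b))

    generators-distinct : ∀ {a b} → a ≢ b → xs a ≢ xs b
    generators-distinct {a} {b} a≢b xₐ≡x_b = distinct a b a≢b (≡⇒≈⟨⟩ xₐ≡x_b)

    module _ {a b} (a≢b : a ≢ b) (ics-a : InIcs G xs a) where
      private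
        b≢a : b ≢ a
        b≢a = ≢-sym a≢b

      -- e is the only common neighbour of x_a and x_b, since it lies in ⟨x_a⟩ ∩ ⟨x_b⟩.
      common-neighbour≡e : ∀ {v} → Adj G (xs a) v → Adj G v (xs b) → v ≡ e
      common-neighbour≡e {v} xₐ~v v~x_b =
        ics-a b b≢a v (maximal-neighbour (maximal a) xₐ~v)
                      (maximal-neighbour (maximal b) (Adj-sym v~x_b))

      -- x_a and x_b are not adjacent: otherwise x_b ∈ ⟨x_a⟩ ∩ ⟨x_b⟩ = {e}.
      not-adjacent : ¬ Adj G (xs a) (xs b)
      not-adjacent xₐ~x_b = generator-≢-e b≢a
        (ics-a b b≢a (xs b) (maximal-neighbour (maximal a) xₐ~x_b) (∈⟨self⟩ (xs b)))

  module FewColours {k} (ζ : EdgeColouring G k) (3≰k : ¬ 3 ≤ k) where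
    open EdgeColouring ζ using (colour)

    -- If x ≠ y are non-adjacent and c is their only common neighbour, a walk from
    -- x to y with distinct edge colours is x — c — y (longer walks would use three
    -- colours), so the two edges at c have different colours.
    through-unique-common-neighbour :
      ∀ {x y c} → x ≢ y → ¬ Adj G x y → (∀ {v} → Adj G x v → Adj G v y → v ≡ c) →
      (w : Walk G x y) → Unique (colours G ζ w) → colour x c ≢ colour c y
    through-unique-common-neighbour x≢y _ _ here _ = contradiction refl x≢y
    through-unique-common-neighbour _ x≁y _ (step here x~y) _ = contradiction x~y x≁y
    through-unique-common-neighbour _ _ common (step (step here x~v) v~y) ((different ∷ _) ∷ _)
      with common x~v v~y
    ... | refl = λ same → different (sym same)
    through-unique-common-neighbour _ _ _ (step (step (step _ _) _) _)
      ((c₁≢c₂ ∷ c₁≢c₃ ∷ _) ∷ (c₂≢c₃ ∷ _) ∷ _) =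
      contradiction (three-distinct⇒3≤ c₁≢c₂ c₁≢c₃ c₂≢c₃) 3≰k

    independent-edges-differ :
      ∀ {m} {xs : Fin m → Carrier} (ess : IsEssentialCyclicSet G m xs) →
      IsRainbowColouring G ζ → ∀ {a b} → a ≢ b → InIcs G xs a →
      colour (xs a) e ≢ colour (xs b) e
    independent-edges-differ {xs = xs} ess rainbow {a} {b} a≢b ics-a same =
      through-unique-common-neighbour xₐ≢x_b (not-adjacent a≢b ics-a)
        (common-neighbour≡e a≢b ics-a) path rainbow-colours same-colour-at-e
      where
      open Independence ess

      xₐ≢x_b : xs a ≢ xs b
      xₐ≢x_b = generators-distinct a≢b

      path : Walk G (xs a) (xs b)
      path = proj₁ (rainbow (xs a) (xs b) xₐ≢x_b)

      rainbow-colours : Unique (colours G ζ path)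
      rainbow-colours = proj₂ (proj₂ (rainbow (xs a) (xs b) xₐ≢x_b))

      same-colour-at-e : colour (xs a) e ≡ colour e (xs b)
      same-colour-at-e =
        trans same (EdgeColouring.sym ζ (xs b) e (adjacent-to-e (generator-≢-e (≢-sym a≢b))))

proposition2p19 : (G : FiniteGroup) (m : ℕ) (xs : Fin m → FiniteGroup.Carrier G) →
    IsEssentialCyclicSet G m xs → IcnAtLeast3 G xs → RcAtLeast G 3
proposition2p19 G m xs ess (i , j , l , i≢j , i≢l , j≢l , ics-i , ics-j , _) k ζ rainbow
  with 3 ≤? k
... | yes 3≤k = 3≤k
... | no 3≰k  = contradiction (three-distinct⇒3≤ (differ i≢j ics-i) (differ i≢l ics-i)
                                                  (differ j≢l ics-j)) 3≰k
  where
  open FiniteGroup G using (e)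
  open EdgeColouring ζ using (colour)
  open CyclicSubgroups.FewColours G ζ 3≰k using (independent-edges-differ)

  differ : ∀ {a b} → a ≢ b → InIcs G xs a → colour (xs a) e ≢ colour (xs b) e
  differ = independent-edges-differ ess rainbow
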